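{- For every integer $g\ge 0$, the number $n'_g$ of gapsets of genus $g$ and depth at most $3$ satisfies $n'_g\ge \mathbf F_{g+2}-\mathbf P_{g+1}$; consequently the number of gapsets of genus $g$ is also at least $\mathbf F_{g+2}-\mathbf P_{g+1}$.
   Context: A gapset is a finite set $G\subset\mathbb N$ (positive integers) such that whenever $z\in G$ and $z=x+y$ with $x,y\in\mathbb N$, then $x\in G$ or $y\in G$. Its genus is $\#G$, its multiplicity is $m(G)=\min\{s\in\mathbb N_0\setminus G: s\ne0\}$, its conductor is $c(G)=\min\{s\in\mathbb N_0: s+n\notin G\ \forall n\in\mathbb N_0\}$, and its depth is $\lceil c(G)/m(G)\rceil$. The Fibonacci sequence: $\mathbf F_0=0$, $\mathbf F_1=1$, $\mathbf F_n=\mathbf F_{n-1}+\mathbf F_{n-2}$. The Padovan sequence $(\mathbf P_n)_{n\ge-3}$: $\mathbf P_{ -3}=1$, $\mathbf P_{ -2}=\mathbf P_{ -1}=0$, $\mathbf P_n=\mathbf P_{n-2}+\mathbf P_{n-3}$ for $n\ge0$. -}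

module Defs where

open import Data.Nat using (ℕ; zero; suc; _+_; _∸_; _≤_; _<_; NonZero)
open import Data.Nat.DivMod using (_/_)
open import Data.List using (List; length)
open import Data.List.Membership.Propositional using (_∈_; _∉_)
open import Data.List.Relation.Unary.All using (All)
open import Data.List.Relation.Unary.AllPairs using (AllPairs)
open import Data.List.Relation.Unary.Unique.Propositional using (Unique)
open import Data.Product using (Σ; _×_; ∃; ∃-syntax)
open import Data.Sum using (_⊎_)
open import Relation.Binary.PropositionalEquality using (_≡_)

fib : ℕ → ℕ
fib zero = 0
fib (suc zero) = 1
fib (suc (suc n)) = fib (suc n) + fib n

-- Shifted Padovan: pad k = P_{k-3}, so pad 0 = P_{-3} = 1, pad 1 = P_{-2} = 0,
-- pad 2 = P_{-1} = 0, and P_n = P_{n-2} + P_{n-3}.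
pad : ℕ → ℕ
pad zero = 1
pad (suc zero) = 0
pad (suc (suc zero)) = 0
pad (suc (suc (suc k))) = pad (suc k) + pad k

padovan : ℕ → ℕ
padovan n = pad (n + 3)

-- A finite subset of ℕ represented canonically as a strictly increasing list.
record FinSet : Set where
  constructor mkFinSet
  field
    elems  : List ℕ
    sorted : AllPairs _<_ elems
open FinSet public

IsGapset : FinSet → Set
IsGapset G =
  All (λ z → 1 ≤ z) (elems G) ×
  (∀ z x y → z ∈ elems G → 1 ≤ x → 1 ≤ y → z ≡ x + y → x ∈ elems G ⊎ y ∈ elems G)

genus : FinSet → ℕ
genus G = length (elems G)

IsMultiplicity : FinSet → ℕ → Set
IsMultiplicity G m = 1 ≤ m × m ∉ elems G × (∀ s → 1 ≤ s → s < m → s ∈ elems G)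

IsConductor : FinSet → ℕ → Set
IsConductor G c =
  (∀ n → c + n ∉ elems G) ×
  (∀ s → s < c → Σ ℕ (λ n → s + n ∈ elems G))

ceilDiv : ℕ → ℕ → ℕ
ceilDiv c k = (c + k) / suc k

DepthAtMost : ℕ → FinSet → Set
DepthAtMost d G = ∃[ k ] ∃[ c ] (IsMultiplicity G (suc k) × IsConductor G c × ceilDiv c k ≤ d)

-- #{G : P G} ≥ a ∸ b, stated without truncated subtraction as:
-- there is a duplicate-free list L of sets satisfying P with a ≤ length L + b.
CountAtLeastDiff : (FinSet → Set) → ℕ → ℕ → Set
CountAtLeastDiff P a b = ∃[ L ] (Unique L × All P L × a ≤ length L + b)

-- Fix m = n + 1 and k ≤ n. A set G ⊆ [1, 2m + k] that contains 1, …, m − 1 and m + 1, …, m + k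
-- but neither m nor 2m is a gapset: if x + y ∈ G with x, y ∉ G, then x, y ≥ m and
-- 2m < x + y ≤ 2m + k, so one of x, y lies in (m, m + k] ⊆ G. Its depth is at most 3 since
-- 2m + k < 3m. Recording G ∩ (m + k, 2m) by a word over {1, 2} and G ∩ (2m, 2m + k] by a word
-- over {2, 3}, with letter weights chosen so that the genus is the total weight, the number
-- a(g) of words of weight g satisfies a(g + 3) = F(g + 3) + a(g + 1) + a(g), whose solution is
-- F(g + 2) − P(g + 1).
module Submission where

open import Defs
open import Data.Bool using (Bool; true; false)
open import Data.List using (List; []; _∷_; _++_; length; replicate; map; head)
open import Data.List.Properties using (length-++; length-replicate; length-map; ++-assoc; ∷-injectiveʳ)
open import Data.List.Membership.Propositional using (_∈_)
open import Data.List.Relation.Unary.Any using (here; there)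
open import Data.List.Relation.Unary.All as All using (All; []; _∷_)
import Data.List.Relation.Unary.All.Properties as All
open import Data.List.Relation.Unary.AllPairs using (AllPairs; []; _∷_)
open import Data.List.Relation.Unary.Unique.Propositional using (Unique)
import Data.List.Relation.Unary.Unique.Propositional.Properties as Unique
open import Data.Maybe using (Maybe; just; nothing)
open import Data.Nat
open import Data.Nat.DivMod using (m<n*o⇒m/o<n)
open import Data.Nat.Properties
open import Data.Nat.Solver using (module +-*-Solver)
open import Data.Product using (_×_; _,_; proj₁; proj₂; ∃-syntax)
import Data.Product
open import Data.Sum using (_⊎_; inj₁; inj₂)
import Data.Sum
open import Function using (_∘_; case_of_)
open import Relation.Nullary using (¬_; yes; no)
open import Relation.Binary.PropositionalEquality

open +-*-Solver

private
  variable
    A : Set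

bitAt : List Bool → ℕ → Bool
bitAt []       _       = false
bitAt (b ∷ bs) zero    = b
bitAt (b ∷ bs) (suc i) = bitAt bs i

trues : List Bool → ℕ
trues []           = 0
trues (true ∷ bs)  = suc (trues bs)
trues (false ∷ bs) = trues bs

positionsFrom : ℕ → List Bool → List ℕ
positionsFrom j []           = []
positionsFrom j (true ∷ bs)  = j ∷ positionsFrom (suc j) bs
positionsFrom j (false ∷ bs) = positionsFrom (suc j) bs

positionsFrom-≥ : ∀ j bs → All (j ≤_) (positionsFrom j bs)
positionsFrom-≥ j []           = []
positionsFrom-≥ j (true ∷ bs)  = ≤-refl ∷ All.map (≤-trans (n≤1+n j)) (positionsFrom-≥ (suc j) bs)
positionsFrom-≥ j (false ∷ bs) = All.map (≤-trans (n≤1+n j)) (positionsFrom-≥ (suc j) bs)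

positionsFrom-< : ∀ j bs → All (_< j + length bs) (positionsFrom j bs)
positionsFrom-< j []           = []
positionsFrom-< j (true ∷ bs)  =
  m<m+n j z<s ∷ All.map (λ {x} → subst (x <_) (sym (+-suc j (length bs)))) (positionsFrom-< (suc j) bs)
positionsFrom-< j (false ∷ bs) =
  All.map (λ {x} → subst (x <_) (sym (+-suc j (length bs)))) (positionsFrom-< (suc j) bs)

positionsFrom-sorted : ∀ j bs → AllPairs _<_ (positionsFrom j bs)
positionsFrom-sorted j []           = []
positionsFrom-sorted j (true ∷ bs)  = positionsFrom-≥ (suc j) bs ∷ positionsFrom-sorted (suc j) bs
positionsFrom-sorted j (false ∷ bs) = positionsFrom-sorted (suc j) bs

length-positionsFrom : ∀ j bs → length (positionsFrom j bs) ≡ trues bs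
length-positionsFrom j []           = refl
length-positionsFrom j (true ∷ bs)  = cong suc (length-positionsFrom (suc j) bs)
length-positionsFrom j (false ∷ bs) = length-positionsFrom (suc j) bs

∈-positionsFrom⁻ : ∀ {x} j bs → x ∈ positionsFrom j bs → ∃[ i ] x ≡ j + i × bitAt bs i ≡ true
∈-positionsFrom⁻ j (true ∷ bs) (here refl) = 0 , sym (+-identityʳ j) , refl
∈-positionsFrom⁻ j (true ∷ bs) (there x∈) with i , refl , bit ← ∈-positionsFrom⁻ (suc j) bs x∈ =
  suc i , sym (+-suc j i) , bit
∈-positionsFrom⁻ j (false ∷ bs) x∈ with i , refl , bit ← ∈-positionsFrom⁻ (suc j) bs x∈ =
  suc i , sym (+-suc j i) , bit

∈-positionsFrom⁺ : ∀ j bs i → bitAt bs i ≡ true → j + i ∈ positionsFrom j bs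
∈-positionsFrom⁺ j (true ∷ bs)  zero    _   = here (+-identityʳ j)
∈-positionsFrom⁺ j (true ∷ bs)  (suc i) bit =
  there (subst (_∈ positionsFrom (suc j) bs) (sym (+-suc j i)) (∈-positionsFrom⁺ (suc j) bs i bit))
∈-positionsFrom⁺ j (false ∷ bs) (suc i) bit =
  subst (_∈ positionsFrom (suc j) bs) (sym (+-suc j i)) (∈-positionsFrom⁺ (suc j) bs i bit)

support : List Bool → FinSet
support bs = mkFinSet (positionsFrom 0 bs) (positionsFrom-sorted 0 bs)

∈-support⁺ : ∀ bs {x} → bitAt bs x ≡ true → x ∈ elems (support bs)
∈-support⁺ bs {x} = ∈-positionsFrom⁺ 0 bs x

∈-support⁻ : ∀ bs {x} → x ∈ elems (support bs) → bitAt bs x ≡ true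
∈-support⁻ bs x∈ with _ , refl , bit ← ∈-positionsFrom⁻ 0 bs x∈ = bit

support-< : ∀ bs → All (_< length bs) (elems (support bs))
support-< bs = positionsFrom-< 0 bs

genus-support : ∀ bs → genus (support bs) ≡ trues bs
genus-support bs = length-positionsFrom 0 bs

bool-ext : ∀ {a b : Bool} → (a ≡ true → b ≡ true) → (b ≡ true → a ≡ true) → a ≡ b
bool-ext {false} {false} _   _   = refl
bool-ext {false} {true}  _   b⇒a = b⇒a refl
bool-ext {true}          a⇒b _   = sym (a⇒b refl)

support-injective-bits : ∀ bs cs → support bs ≡ support cs → bitAt bs ≗ bitAt cs
support-injective-bits bs cs eq x = bool-ext
  (λ bit → ∈-support⁻ cs (subst (λ G → x ∈ elems G) eq (∈-support⁺ bs bit)))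
  (λ bit → ∈-support⁻ bs (subst (λ G → x ∈ elems G) (sym eq) (∈-support⁺ cs bit)))

bitAt-true⇒< : ∀ bs {i} → bitAt bs i ≡ true → i < length bs
bitAt-true⇒< (b ∷ bs) {zero}  _   = z<s
bitAt-true⇒< (b ∷ bs) {suc i} bit = s<s (bitAt-true⇒< bs bit)

bitAt-replicate-++ : ∀ n ys {i} → i < n → bitAt (replicate n true ++ ys) i ≡ true
bitAt-replicate-++ (suc n) ys {zero}  _         = refl
bitAt-replicate-++ (suc n) ys {suc i} (s<s i<n) = bitAt-replicate-++ n ys i<n

bitAt-++-+ : ∀ xs ys {p} i → length xs + i ≡ p → bitAt (xs ++ ys) p ≡ bitAt ys i
bitAt-++-+ []       ys i refl = refl
bitAt-++-+ (x ∷ xs) ys i refl = bitAt-++-+ xs ys i refl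

bitAt-∷-≗ : ∀ {b c bs cs} → bitAt (b ∷ bs) ≗ bitAt (c ∷ cs) → b ≡ c × bitAt bs ≗ bitAt cs
bitAt-∷-≗ same = same 0 , same ∘ suc

bitAt-++-≗ : ∀ xs ys {X Y} → length xs ≡ length ys →
             bitAt (xs ++ X) ≗ bitAt (ys ++ Y) → xs ≡ ys × bitAt X ≗ bitAt Y
bitAt-++-≗ []       []       _   same = refl , same
bitAt-++-≗ (x ∷ xs) (y ∷ ys) len same =
  let x≡y , same′ = bitAt-∷-≗ same
      xs≡ys , rest = bitAt-++-≗ xs ys (suc-injective len) same′
  in cong₂ _∷_ x≡y xs≡ys , rest

bitAt-run-≗ : ∀ m n {X Y} →
              bitAt (replicate m true ++ false ∷ X) ≗ bitAt (replicate n true ++ false ∷ Y) →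
              m ≡ n × bitAt X ≗ bitAt Y
bitAt-run-≗ zero    zero    same = refl , proj₂ (bitAt-∷-≗ same)
bitAt-run-≗ zero    (suc n) same = case same 0 of λ ()
bitAt-run-≗ (suc m) zero    same = case same 0 of λ ()
bitAt-run-≗ (suc m) (suc n) same =
  let m≡n , rest = bitAt-run-≗ m n (same ∘ suc) in cong suc m≡n , rest

bitAt-≗⇒≡ : ∀ xs ys → length xs ≡ length ys → bitAt xs ≗ bitAt ys → xs ≡ ys
bitAt-≗⇒≡ []       []       _   _    = refl
bitAt-≗⇒≡ (x ∷ xs) (y ∷ ys) len same =
  cong₂ _∷_ (same 0) (bitAt-≗⇒≡ xs ys (suc-injective len) (same ∘ suc))

trues-++ : ∀ bs cs → trues (bs ++ cs) ≡ trues bs + trues cs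
trues-++ []           cs = refl
trues-++ (true ∷ bs)  cs = cong suc (trues-++ bs cs)
trues-++ (false ∷ bs) cs = trues-++ bs cs

trues-replicate : ∀ n → trues (replicate n true) ≡ n
trues-replicate zero    = refl
trues-replicate (suc n) = cong suc (trues-replicate n)

strictSup : List ℕ → ℕ
strictSup []       = 0
strictSup (x ∷ xs) = suc x ⊔ strictSup xs

<-strictSup : ∀ {x} xs → x ∈ xs → x < strictSup xs
<-strictSup (y ∷ xs) (here refl) = m≤m⊔n (suc y) (strictSup xs)
<-strictSup (y ∷ xs) (there x∈) = ≤-trans (<-strictSup xs x∈) (m≤n⊔m (suc y) (strictSup xs))

strictSup-≤ : ∀ {b} xs → All (_< b) xs → strictSup xs ≤ b
strictSup-≤ []       []         = z≤n
strictSup-≤ (x ∷ xs) (x<b ∷ xs<b) = ⊔-lub x<b (strictSup-≤ xs xs<b)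

strictSup-attained : ∀ xs s → s < strictSup xs → ∃[ t ] s + t ∈ xs
strictSup-attained (x ∷ xs) s s< with ≤-total (suc x) (strictSup xs)
... | inj₁ x<sup =
  let t , s+t∈ = strictSup-attained xs s (subst (s <_) (m≤n⇒m⊔n≡n x<sup) s<) in t , there s+t∈
... | inj₂ sup≤x = x ∸ s , here (m+[n∸m]≡n (s≤s⁻¹ (subst (s <_) (m≥n⇒m⊔n≡m sup≤x) s<)))

conductor-strictSup : ∀ G → IsConductor G (strictSup (elems G))
conductor-strictSup G =
  (λ n c+n∈ → <-irrefl refl (≤-<-trans (m≤m+n _ n) (<-strictSup (elems G) c+n∈))) ,
  strictSup-attained (elems G)

ceilDiv-≤ : ∀ c k d → c ≤ d * suc k → ceilDiv c k ≤ d
ceilDiv-≤ c k d c≤ = s≤s⁻¹ (m<n*o⇒m/o<n {n = suc d} c+k<)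
  where
    c+k< : c + k < suc d * suc k
    c+k< = subst (_≤ suc d * suc k) (cong suc (+-comm k c)) (+-monoʳ-≤ (suc k) c≤)

depthAtMost : ∀ d G k → IsMultiplicity G (suc k) → All (_< d * suc k) (elems G) → DepthAtMost d G
depthAtMost d G k mult bounded =
  k , strictSup (elems G) , mult , conductor-strictSup G ,
  ceilDiv-≤ _ k d (strictSup-≤ (elems G) bounded)

depth3Run : List Bool → List Bool → ℕ
depth3Run r s = length r + length s

middleBlock : List Bool → List Bool → List Bool
middleBlock r s = replicate (length r) true ++ s

length-middleBlock : ∀ r s → length (middleBlock r s) ≡ depth3Run r s
length-middleBlock r s =
  trans (length-++ (replicate (length r) true)) (cong (_+ length s) (length-replicate (length r)))

-- Bit i records whether i ∈ G. The multiplicity is m = 1 + depth3Run r s, the middle block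
-- records G ∩ (m, 2m) and r records G ∩ (2m, 2m + length r].
depth3Bits : List Bool → List Bool → List Bool
depth3Bits r s = false ∷ replicate (depth3Run r s) true ++ false ∷ middleBlock r s ++ false ∷ r

module Depth3 (r s : List Bool) where

  n : ℕ
  n = depth3Run r s

  bits : List Bool
  bits = depth3Bits r s

  bits-below : ∀ {i} → i < n → bitAt bits (suc i) ≡ true
  bits-below = bitAt-replicate-++ n _

  bits-mult : bitAt bits (suc n) ≡ false
  bits-mult = bitAt-++-+ (replicate n true) _ 0 (trans (+-identityʳ _) (length-replicate n))

  bits-middle : ∀ {a} → a < length r → bitAt bits (suc n + suc a) ≡ true
  bits-middle {a} a<r = begin
    bitAt bits (suc n + suc a)
      ≡⟨ bitAt-++-+ (replicate n true) _ (suc a) (cong (_+ suc a) (length-replicate n)) ⟩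
    bitAt (middleBlock r s ++ false ∷ r) a
      ≡⟨ cong (λ xs → bitAt xs a) (++-assoc (replicate (length r) true) s _) ⟩
    bitAt (replicate (length r) true ++ s ++ false ∷ r) a
      ≡⟨ bitAt-replicate-++ (length r) _ a<r ⟩
    true
      ∎
    where open ≡-Reasoning

  bits-top : ∀ k → bitAt bits (suc n + suc n + k) ≡ bitAt (false ∷ r) k
  bits-top k = begin
    bitAt bits (suc n + suc n + k)
      ≡⟨ bitAt-++-+ (replicate n true) _ (suc (n + k)) shift ⟩
    bitAt (middleBlock r s ++ false ∷ r) (n + k)
      ≡⟨ bitAt-++-+ (middleBlock r s) _ k (cong (_+ k) (length-middleBlock r s)) ⟩
    bitAt (false ∷ r) k
      ∎
    where
      open ≡-Reasoning
      shift : length (replicate n true) + suc (n + k) ≡ n + suc n + k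
      shift = trans (cong (_+ suc (n + k)) (length-replicate n)) (sym (+-assoc n (suc n) k))

  -- Summands m + a and m + b: a + b ≠ 0 since 2m ∉ G, and a + b ≤ length r since G ⊆ [1, 2m + length r].
  closed-above-2m : ∀ a b → bitAt bits (suc n + suc n + (a + b)) ≡ true →
                    bitAt bits (suc n + a) ≡ true ⊎ bitAt bits (suc n + b) ≡ true
  closed-above-2m zero    zero    bit = case trans (sym bit) (bits-top 0) of λ ()
  closed-above-2m zero    (suc b) bit =
    inj₂ (bits-middle (bitAt-true⇒< r (trans (sym (bits-top (suc b))) bit)))
  closed-above-2m (suc a) b       bit =
    inj₁ (bits-middle (≤-<-trans (m≤m+n a b) (bitAt-true⇒< r (trans (sym (bits-top (suc (a + b)))) bit))))

  closed : ∀ x y → bitAt bits (x + y) ≡ true → 1 ≤ x → 1 ≤ y →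
           bitAt bits x ≡ true ⊎ bitAt bits y ≡ true
  closed (suc x) (suc y) bit _ _ with x <? n | y <? n
  ... | yes x<n | _       = inj₁ (bits-below x<n)
  ... | no _    | yes y<n = inj₂ (bits-below y<n)
  ... | no x≮n  | no y≮n
    with a , refl ← m≤n⇒∃[o]m+o≡n (≮⇒≥ x≮n) | b , refl ← m≤n⇒∃[o]m+o≡n (≮⇒≥ y≮n) =
    closed-above-2m a b (subst (λ p → bitAt bits p ≡ true) (regroup n a b) bit)
    where
      regroup : ∀ n a b → suc (n + a) + suc (n + b) ≡ suc n + suc n + (a + b)
      regroup = solve 3 (λ n a b → (con 1 :+ (n :+ a)) :+ (con 1 :+ (n :+ b)) :=
                                   (con 1 :+ n) :+ (con 1 :+ n) :+ (a :+ b)) refl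

  isGapset : IsGapset (support bits)
  isGapset = All.tabulate positive , λ z x y z∈ 1≤x 1≤y z≡x+y →
    Data.Sum.map (∈-support⁺ bits) (∈-support⁺ bits)
      (closed x y (subst (λ p → bitAt bits p ≡ true) z≡x+y (∈-support⁻ bits z∈)) 1≤x 1≤y)
    where
      positive : ∀ {x} → x ∈ elems (support bits) → 1 ≤ x
      positive {zero}  0∈ = case ∈-support⁻ bits 0∈ of λ ()
      positive {suc x} _  = s≤s z≤n

  multiplicity : IsMultiplicity (support bits) (suc n)
  multiplicity = s≤s z≤n ,
    (λ m∈ → case trans (sym (∈-support⁻ bits m∈)) bits-mult of λ ()) ,
    λ { zero () _ ; (suc i) _ (s≤s i<n) → ∈-support⁺ bits (bits-below i<n) }

  length-bits : length bits ≡ suc (n + suc (n + suc (length r)))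
  length-bits = cong suc (trans (length-++ (replicate n true)) (cong₂ _+_ (length-replicate n)
    (cong suc (trans (length-++ (middleBlock r s)) (cong (_+ suc (length r)) (length-middleBlock r s))))))

  length-bits-≤ : length bits ≤ 3 * suc n
  length-bits-≤ = ≤-trans (≤-reflexive length-bits)
    (s≤s (+-monoʳ-≤ n (s≤s (+-monoʳ-≤ n (s≤s (m≤n⇒m≤n+o 0 (m≤m+n (length r) (length s))))))))

  depth : DepthAtMost 3 (support bits)
  depth = depthAtMost 3 (support bits) n multiplicity
    (All.map (λ x< → <-≤-trans x< length-bits-≤) (support-< bits))

  trues-bits : trues bits ≡ n + ((length r + trues s) + trues r)
  trues-bits = trans (trues-++ (replicate n true) _) (cong₂ _+_ (trues-replicate n)
    (trans (trues-++ (middleBlock r s) _) (cong (_+ trues r) trues-middleBlock)))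
    where
      trues-middleBlock : trues (middleBlock r s) ≡ length r + trues s
      trues-middleBlock = trans (trues-++ (replicate (length r) true) s)
                                (cong (_+ trues s) (trues-replicate (length r)))

  support-injective-blocks : ∀ r′ s′ → support bits ≡ support (depth3Bits r′ s′) →
                             middleBlock r s ≡ middleBlock r′ s′ × bitAt r ≗ bitAt r′
  support-injective-blocks r′ s′ eq =
    let same = support-injective-bits bits (depth3Bits r′ s′) eq
        runs , rest = bitAt-run-≗ n (depth3Run r′ s′) (proj₂ (bitAt-∷-≗ same))
        mids , tops = bitAt-++-≗ (middleBlock r s) (middleBlock r′ s′)
                        (trans (length-middleBlock r s) (trans runs (sym (length-middleBlock r′ s′)))) rest
    in mids , proj₂ (bitAt-∷-≗ tops)

-- (u , v) encodes the gapset with top block u and middle block true^(length u) ++ middleTail v;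
-- the false opening middleTail is what makes the encoding injective.
Word : Set
Word = List Bool × Maybe (List Bool)

middleTail : Maybe (List Bool) → List Bool
middleTail nothing  = []
middleTail (just t) = false ∷ t

encode : Word → FinSet
encode (u , v) = support (depth3Bits u (middleTail v))

weight₂₃ : List Bool → ℕ
weight₂₃ []          = 0
weight₂₃ (false ∷ u) = 2 + weight₂₃ u
weight₂₃ (true ∷ u)  = 3 + weight₂₃ u

weight₁₂ : List Bool → ℕ
weight₁₂ []          = 0
weight₁₂ (false ∷ t) = 1 + weight₁₂ t
weight₁₂ (true ∷ t)  = 2 + weight₁₂ t

tailWeight : Maybe (List Bool) → ℕ
tailWeight nothing  = 0
tailWeight (just t) = suc (weight₁₂ t)

weight : Word → ℕ
weight (u , v) = weight₂₃ u + tailWeight v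

weight₂₃-≡ : ∀ u → weight₂₃ u ≡ length u + length u + trues u
weight₂₃-≡ []          = refl
weight₂₃-≡ (false ∷ u) = trans (cong (2 +_) (weight₂₃-≡ u)) (regroup (length u) (trues u))
  where
    regroup : ∀ k d → 2 + (k + k + d) ≡ suc k + suc k + d
    regroup = solve 2 (λ k d → con 2 :+ (k :+ k :+ d) := (con 1 :+ k) :+ (con 1 :+ k) :+ d) refl
weight₂₃-≡ (true ∷ u)  = trans (cong (3 +_) (weight₂₃-≡ u)) (regroup (length u) (trues u))
  where
    regroup : ∀ k d → 3 + (k + k + d) ≡ suc k + suc k + suc d
    regroup = solve 2 (λ k d → con 3 :+ (k :+ k :+ d) := (con 1 :+ k) :+ (con 1 :+ k) :+ (con 1 :+ d)) refl

weight₁₂-≡ : ∀ t → weight₁₂ t ≡ length t + trues t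
weight₁₂-≡ []          = refl
weight₁₂-≡ (false ∷ t) = cong suc (weight₁₂-≡ t)
weight₁₂-≡ (true ∷ t)  = trans (cong (2 +_) (weight₁₂-≡ t)) (cong suc (sym (+-suc (length t) (trues t))))

tailWeight-≡ : ∀ v → tailWeight v ≡ length (middleTail v) + trues (middleTail v)
tailWeight-≡ nothing  = refl
tailWeight-≡ (just t) = cong suc (weight₁₂-≡ t)

encode-isGapset : ∀ w → IsGapset (encode w)
encode-isGapset (u , v) = Depth3.isGapset u (middleTail v)

encode-depth : ∀ w → DepthAtMost 3 (encode w)
encode-depth (u , v) = Depth3.depth u (middleTail v)

genus-encode : ∀ w → genus (encode w) ≡ weight w
genus-encode (u , v) = begin
  genus (support (depth3Bits u s))                  ≡⟨ genus-support (depth3Bits u s) ⟩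
  trues (depth3Bits u s)                            ≡⟨ Depth3.trues-bits u s ⟩
  (k + length s) + ((k + trues s) + trues u)        ≡⟨ regroup k (length s) (trues s) (trues u) ⟩
  (k + k + trues u) + (length s + trues s)          ≡⟨ sym (cong₂ _+_ (weight₂₃-≡ u) (tailWeight-≡ v)) ⟩
  weight₂₃ u + tailWeight v                         ∎
  where
    open ≡-Reasoning
    k = length u
    s = middleTail v
    regroup : ∀ k l c d → (k + l) + ((k + c) + d) ≡ (k + k + d) + (l + c)
    regroup = solve 4 (λ k l c d → (k :+ l) :+ ((k :+ c) :+ d) := (k :+ k :+ d) :+ (l :+ c)) refl

replicate-++-middleTail-injective : ∀ k k′ v v′ →
  replicate k true ++ middleTail v ≡ replicate k′ true ++ middleTail v′ → k ≡ k′ × v ≡ v′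
replicate-++-middleTail-injective zero    zero     nothing  nothing  refl = refl , refl
replicate-++-middleTail-injective zero    zero     (just t) (just t) refl = refl , refl
replicate-++-middleTail-injective zero    zero     nothing  (just _) ()
replicate-++-middleTail-injective zero    zero     (just _) nothing  ()
replicate-++-middleTail-injective zero    (suc _)  nothing  _        ()
replicate-++-middleTail-injective zero    (suc _)  (just _) _        ()
replicate-++-middleTail-injective (suc _) zero     _        nothing  ()
replicate-++-middleTail-injective (suc _) zero     _        (just _) ()
replicate-++-middleTail-injective (suc k) (suc k′) v        v′       eq =
  let k≡k′ , v≡v′ = replicate-++-middleTail-injective k k′ v v′ (∷-injectiveʳ eq)
  in cong suc k≡k′ , v≡v′

encode-injective : ∀ {w w′} → encode w ≡ encode w′ → w ≡ w′
encode-injective {u , v} {u′ , v′} eq =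
  let mids , tops = Depth3.support-injective-blocks u (middleTail v) u′ (middleTail v′) eq
      lengths , v≡v′ = replicate-++-middleTail-injective (length u) (length u′) v v′ mids
  in cong₂ _,_ (bitAt-≗⇒≡ u u′ lengths tops) v≡v′

compositions : ℕ → List (List Bool)
compositions zero          = [] ∷ []
compositions (suc zero)    = (false ∷ []) ∷ []
compositions (suc (suc g)) = map (false ∷_) (compositions (suc g)) ++ map (true ∷_) (compositions g)

withoutTop : List Bool → Word
withoutTop t = [] , just t

prepend : Bool → Word → Word
prepend b (u , v) = b ∷ u , v

words : ℕ → List Word
words zero                = ([] , nothing) ∷ []
words (suc zero)          = withoutTop [] ∷ []
words (suc (suc zero))    = withoutTop (false ∷ []) ∷ prepend false ([] , nothing) ∷ []
words (suc (suc (suc g))) =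
  map withoutTop (compositions (suc (suc g))) ++
  map (prepend false) (words (suc g)) ++
  map (prepend true) (words g)

length-compositions : ∀ g → length (compositions g) ≡ fib (suc g)
length-compositions zero          = refl
length-compositions (suc zero)    = refl
length-compositions (suc (suc g)) = begin
  length (map (false ∷_) (compositions (suc g)) ++ map (true ∷_) (compositions g))
    ≡⟨ length-++ (map (false ∷_) (compositions (suc g))) ⟩
  length (map (false ∷_) (compositions (suc g))) + length (map (true ∷_) (compositions g))
    ≡⟨ cong₂ _+_ (length-map _ (compositions (suc g))) (length-map _ (compositions g)) ⟩
  length (compositions (suc g)) + length (compositions g)
    ≡⟨ cong₂ _+_ (length-compositions (suc g)) (length-compositions g) ⟩
  fib (suc (suc (suc g)))
    ∎
  where open ≡-Reasoning

length-words : ∀ g → length (words g) + pad (4 + g) ≡ fib (2 + g)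
length-words zero             = refl
length-words (suc zero)       = refl
length-words (suc (suc zero)) = refl
length-words (suc (suc (suc g))) = begin
  length (words (3 + g)) + (pad (5 + g) + pad (4 + g))
    ≡⟨ cong (_+ (pad (5 + g) + pad (4 + g))) length-split ⟩
  (c + (a₁ + a₀)) + (pad (5 + g) + pad (4 + g))
    ≡⟨ regroup c a₁ a₀ (pad (5 + g)) (pad (4 + g)) ⟩
  c + ((a₁ + pad (5 + g)) + (a₀ + pad (4 + g)))
    ≡⟨ cong₂ _+_ (length-compositions (2 + g)) (cong₂ _+_ (length-words (suc g)) (length-words g)) ⟩
  fib (3 + g) + fib (4 + g)
    ≡⟨ +-comm (fib (3 + g)) (fib (4 + g)) ⟩
  fib (5 + g)
    ∎
  where
    open ≡-Reasoning
    c  = length (compositions (2 + g))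
    a₁ = length (words (1 + g))
    a₀ = length (words g)
    length-split : length (words (3 + g)) ≡ c + (a₁ + a₀)
    length-split = trans (length-++ (map withoutTop (compositions (2 + g))))
      (cong₂ _+_ (length-map withoutTop (compositions (2 + g)))
        (trans (length-++ (map (prepend false) (words (1 + g))))
          (cong₂ _+_ (length-map (prepend false) (words (1 + g))) (length-map (prepend true) (words g)))))
    regroup : ∀ c a₁ a₀ p₁ p₀ → (c + (a₁ + a₀)) + (p₁ + p₀) ≡ c + ((a₁ + p₁) + (a₀ + p₀))
    regroup = solve 5 (λ c a₁ a₀ p₁ p₀ → (c :+ (a₁ :+ a₀)) :+ (p₁ :+ p₀) :=
                                          c :+ ((a₁ :+ p₁) :+ (a₀ :+ p₀))) refl

weight-compositions : ∀ g → All (λ t → weight₁₂ t ≡ g) (compositions g)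
weight-compositions zero          = refl ∷ []
weight-compositions (suc zero)    = refl ∷ []
weight-compositions (suc (suc g)) = All.++⁺
  (All.map⁺ (All.map (cong suc) (weight-compositions (suc g))))
  (All.map⁺ (All.map (cong (2 +_)) (weight-compositions g)))

weight-words : ∀ g → All (λ w → weight w ≡ g) (words g)
weight-words zero                = refl ∷ []
weight-words (suc zero)          = refl ∷ []
weight-words (suc (suc zero))    = refl ∷ refl ∷ []
weight-words (suc (suc (suc g))) = All.++⁺
  (All.map⁺ (All.map (cong suc) (weight-compositions (2 + g))))
  (All.++⁺ (All.map⁺ (All.map (cong (2 +_)) (weight-words (suc g))))
           (All.map⁺ (All.map (cong (3 +_)) (weight-words g))))

unique-++-separated : ∀ (P : A → Set) {xs ys} → All P xs → All (¬_ ∘ P) ys →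
                      Unique xs → Unique ys → Unique (xs ++ ys)
unique-++-separated P Pxs ¬Pys uxs uys =
  Unique.++⁺ uxs uys (λ (x∈xs , x∈ys) → All.lookup ¬Pys x∈ys (All.lookup Pxs x∈xs))

unique-compositions : ∀ g → Unique (compositions g)
unique-compositions zero          = [] ∷ []
unique-compositions (suc zero)    = [] ∷ []
unique-compositions (suc (suc g)) = unique-++-separated (λ t → head t ≡ just false)
  (All.map⁺ (All.universal (λ _ → refl) (compositions (suc g))))
  (All.map⁺ (All.universal (λ _ ()) (compositions g)))
  (Unique.map⁺ ∷-injectiveʳ (unique-compositions (suc g)))
  (Unique.map⁺ ∷-injectiveʳ (unique-compositions g))

prepend-injective : ∀ b {w w′} → prepend b w ≡ prepend b w′ → w ≡ w′
prepend-injective b {_ , _} {_ , _} refl = refl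

unique-words : ∀ g → Unique (words g)
unique-words zero                = [] ∷ []
unique-words (suc zero)          = [] ∷ []
unique-words (suc (suc zero))    = ((λ ()) ∷ []) ∷ [] ∷ []
unique-words (suc (suc (suc g))) = unique-++-separated (λ w → proj₁ w ≡ [])
  (All.map⁺ (All.universal (λ _ → refl) (compositions (2 + g))))
  (All.++⁺ (All.map⁺ (All.universal (λ _ ()) (words (1 + g))))
           (All.map⁺ (All.universal (λ _ ()) (words g))))
  (Unique.map⁺ (λ { refl → refl }) (unique-compositions (2 + g)))
  (unique-++-separated (λ w → head (proj₁ w) ≡ just false)
    (All.map⁺ (All.universal (λ _ → refl) (words (1 + g))))
    (All.map⁺ (All.universal (λ _ ()) (words g)))
    (Unique.map⁺ (prepend-injective false) (unique-words (suc g)))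
    (Unique.map⁺ (prepend-injective true) (unique-words g)))

corollary5p4 : (g : ℕ) →
    CountAtLeastDiff (λ G → IsGapset G × genus G ≡ g × DepthAtMost 3 G) (fib (g + 2)) (padovan (g + 1))
    × CountAtLeastDiff (λ G → IsGapset G × genus G ≡ g) (fib (g + 2)) (padovan (g + 1))
corollary5p4 g =
  (gapsets , unique , valid , count) , (gapsets , unique , All.map (Data.Product.map₂ proj₁) valid , count)
  where
    gapsets : List FinSet
    gapsets = map encode (words g)
    unique : Unique gapsets
    unique = Unique.map⁺ encode-injective (unique-words g)
    valid : All (λ G → IsGapset G × genus G ≡ g × DepthAtMost 3 G) gapsets
    valid = All.map⁺ (All.map
      (λ {w} weight≡g → encode-isGapset w , trans (genus-encode w) weight≡g , encode-depth w)
      (weight-words g))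
    count : fib (g + 2) ≤ length gapsets + padovan (g + 1)
    count = ≤-reflexive (begin
      fib (g + 2)                            ≡⟨ cong fib (+-comm g 2) ⟩
      fib (2 + g)                            ≡⟨ sym (length-words g) ⟩
      length (words g) + pad (4 + g)         ≡⟨ cong₂ _+_ (sym (length-map encode (words g))) (cong pad shift) ⟩
      length gapsets + padovan (g + 1)       ∎)
      where
        open ≡-Reasoning
        shift : 4 + g ≡ g + 1 + 3
        shift = sym (trans (+-assoc g 1 3) (+-comm g 4))
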